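{- Let $\mathcal{K}$ be the class of algebras $(A,\wedge,\vee,\neg,\Box)$ such that $(A,\wedge,\vee)$ is a lattice, $\neg a=\max\{b\in A: a\wedge b\le c \text{ for all } c\in A\}$ for every $a\in A$, and $\Box a=\max\{b\in A: a\vee\neg b=1\}$ for every $a\in A$ (where $1$ is the top element). Then $\mathcal{K}$ is an equational class. More precisely, writing $1$ for the term $\neg(x\wedge\neg x)$ and $s\preccurlyeq t$ for the identity $s\wedge t\approx s$, $\mathcal{K}$ is exactly the class of algebras of type $(2,2,1,1)$ satisfying the lattice identities together with $x\wedge\neg x\preccurlyeq y$, $\; y\preccurlyeq\neg(x\wedge\neg x)$, $\; x\wedge\neg(x\wedge y)\preccurlyeq\neg y$, $x\vee\neg\Box x\approx 1$, $\;\Box 1\approx 1$, $\;\Box(x\vee\neg y)\wedge y\approx\Box x\wedge y$.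
   Context: Lattices here are not assumed distributive. A lattice in which $\neg a$ (as defined) exists for every $a$ is called meet-complemented; it is automatically bounded, with least element $0$ and greatest element $1=\neg(a\wedge\neg a)$ for any $a$. -}

module Defs where

open import Level using (Level)
open import Data.Product using (_×_)
open import Relation.Binary.PropositionalEquality using (_≡_)
open import Algebra.Core using (Op₁; Op₂)
open import Algebra.Lattice.Structures using (IsLattice)

module _ {ℓ : Level} {A : Set ℓ} (_∧_ _∨_ : Op₂ A) (¬_ □_ : Op₁ A) where

  infix 4 _≤_
  _≤_ : A → A → Set ℓ
  a ≤ b = (a ∧ b) ≡ a

  IsTop : A → Set ℓ
  IsTop t = ∀ c → c ≤ t

  InK : Set ℓ
  InK = IsLattice _≡_ _∨_ _∧_
      -- ¬ a = max { b : a ∧ b ≤ c for all c }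
      × (∀ a → (∀ c → (a ∧ (¬ a)) ≤ c))
      × (∀ a b → (∀ c → (a ∧ b) ≤ c) → b ≤ ¬ a)
      -- □ a = max { b : a ∨ ¬ b = 1 }, 1 the top element
      × (∀ a → IsTop (a ∨ (¬ (□ a))))
      × (∀ a b → IsTop (a ∨ (¬ b)) → b ≤ □ a)

  one : A → A
  one x = ¬ (x ∧ (¬ x))

  InEq : Set ℓ
  InEq = IsLattice _≡_ _∨_ _∧_
       × (∀ x y → (x ∧ (¬ x)) ≤ y)
       × (∀ x y → y ≤ one x)
       × (∀ x y → (x ∧ (¬ (x ∧ y))) ≤ ¬ y)
       × (∀ x → (x ∨ (¬ (□ x))) ≡ one x)
       × (∀ x → □ (one x) ≡ one x)
       × (∀ x y → ((□ (x ∨ (¬ y))) ∧ y) ≡ ((□ x) ∧ y))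

module Submission where

-- The proof splits the two maximum conditions apart and characterises each
-- one equationally, for an arbitrary lattice:
--   * MeetComplement: if a ∧ ¬ a is always a least element, then ¬ a is the
--     largest b with a ∧ b least exactly when ¬ (x ∧ ¬ x) is a top element
--     and x ∧ ¬ (x ∧ y) ≤ ¬ y; such a ¬ is moreover antitone.
--   * Interior: given an antitone ¬ and a □ with a ∨ ¬ □ a always a top, □ a
--     is the largest b with a ∨ ¬ b a top exactly when □ fixes the top and
--     □ (x ∨ ¬ y) ∧ y = □ x ∧ y.
-- A lattice has at most one top element, so "a ∨ ¬ □ a is a top" may be
-- replaced by the identity a ∨ ¬ □ a = ¬ (a ∧ ¬ a).

open import Defs using (InK; InEq)
open import Level using (Level)
open import Algebra.Core using (Op₁; Op₂)
open import Function.Bundles using (_⇔_; mk⇔)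
open import Data.Product using (_,_)
open import Relation.Binary.PropositionalEquality
  using (_≡_; refl; sym; trans; cong; subst; module ≡-Reasoning)
open import Algebra.Lattice.Structures using (IsLattice)
open import Algebra.Lattice.Bundles using (Lattice)
import Algebra.Lattice.Properties.Lattice as AlgebraicLattice
import Relation.Binary.Lattice as OrderLattice
import Relation.Binary.Lattice.Properties.JoinSemilattice as JoinProperties

module MeetOrder {ℓ : Level} {A : Set ℓ} (_∧_ _∨_ : Op₂ A)
                 (isLattice : IsLattice _≡_ _∨_ _∧_) where

  infix 4 _≤_
  _≤_ : A → A → Set ℓ
  a ≤ b = (a ∧ b) ≡ a

  IsGreatest : A → Set ℓ
  IsGreatest t = ∀ c → c ≤ t

  private
    lattice : Lattice ℓ ℓ
    lattice = record { isLattice = isLattice }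

    open OrderLattice.Lattice (AlgebraicLattice.∨-∧-orderTheoreticLattice lattice)
      using (joinSemilattice; x∧y≤x; x∧y≤y; ∧-greatest; x≤x∨y; y≤x∨y; ∨-least)
      renaming (_≤_ to _≤ˢ_; refl to reflˢ; trans to transˢ; antisym to antisymˢ)
    open JoinProperties joinSemilattice using (∨-monotonic)

    -- the library order is the same relation read right to left
    fromˢ : ∀ {a b} → a ≤ˢ b → a ≤ b
    fromˢ = sym

    toˢ : ∀ {a b} → a ≤ b → a ≤ˢ b
    toˢ = sym

  ≤-trans : ∀ {a b c} → a ≤ b → b ≤ c → a ≤ c
  ≤-trans p q = fromˢ (transˢ (toˢ p) (toˢ q))

  ≤-antisym : ∀ {a b} → a ≤ b → b ≤ a → a ≡ b
  ≤-antisym p q = antisymˢ (toˢ p) (toˢ q)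

  ≤-respˡ : ∀ {a a' b} → a ≡ a' → a' ≤ b → a ≤ b
  ≤-respˡ refl p = p

  ∧-lowerˡ : ∀ a b → (a ∧ b) ≤ a
  ∧-lowerˡ a b = fromˢ (x∧y≤x a b)

  ∧-lowerʳ : ∀ a b → (a ∧ b) ≤ b
  ∧-lowerʳ a b = fromˢ (x∧y≤y a b)

  ∧-glb : ∀ {a b c} → c ≤ a → c ≤ b → c ≤ (a ∧ b)
  ∧-glb p q = fromˢ (∧-greatest (toˢ p) (toˢ q))

  ∨-upperˡ : ∀ a b → a ≤ (a ∨ b)
  ∨-upperˡ a b = fromˢ (x≤x∨y a b)

  ∨-upperʳ : ∀ a b → b ≤ (a ∨ b)
  ∨-upperʳ a b = fromˢ (y≤x∨y a b)

  ∨-lub : ∀ {a b c} → a ≤ c → b ≤ c → (a ∨ b) ≤ c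
  ∨-lub p q = fromˢ (∨-least (toˢ p) (toˢ q))

  ∨-monoˡ : ∀ {a a'} b → a ≤ a' → (a ∨ b) ≤ (a' ∨ b)
  ∨-monoˡ b p = fromˢ (∨-monotonic (toˢ p) reflˢ)

  greatest-unique : ∀ {t u} → IsGreatest t → IsGreatest u → t ≡ u
  greatest-unique t-top u-top = ≤-antisym (u-top _) (t-top _)

module MeetComplement {ℓ : Level} {A : Set ℓ} (_∧_ _∨_ : Op₂ A) (¬_ : Op₁ A)
                      (isLattice : IsLattice _≡_ _∨_ _∧_) where
  open IsLattice isLattice using (∧-comm; ∧-assoc)
  open MeetOrder _∧_ _∨_ isLattice

  NegLeast : Set ℓ
  NegLeast = ∀ a c → (a ∧ (¬ a)) ≤ c

  NegMaximal : Set ℓ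
  NegMaximal = ∀ a b → (∀ c → (a ∧ b) ≤ c) → b ≤ ¬ a

  NegAbsorption : Set ℓ
  NegAbsorption = ∀ x y → (x ∧ (¬ (x ∧ y))) ≤ ¬ y

  module _ (least : NegLeast) where

    -- ¬ (x ∧ ¬ x) is a top: everything meets x ∧ ¬ x in a least element.
    maximal⇒top : NegMaximal → ∀ x → IsGreatest (¬ (x ∧ (¬ x)))
    maximal⇒top maximal x y =
      maximal (x ∧ (¬ x)) y (λ c → ≤-trans (∧-lowerˡ _ y) (least x c))

    -- y ∧ (x ∧ ¬ (x ∧ y)) = (x ∧ y) ∧ ¬ (x ∧ y) is least.
    maximal⇒absorption : NegMaximal → NegAbsorption
    maximal⇒absorption maximal x y = maximal y (x ∧ (¬ (x ∧ y))) λ c →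
      ≤-respˡ (trans (sym (∧-assoc y x _)) (cong (_∧ (¬ (x ∧ y))) (∧-comm y x)))
              (least (x ∧ y) c)

    -- ¬ reverses the order: b ∧ ¬ b' ≤ b' ∧ ¬ b' is least when b ≤ b'.
    maximal⇒antitone : NegMaximal → ∀ {b b'} → b ≤ b' → (¬ b') ≤ (¬ b)
    maximal⇒antitone maximal {b} {b'} b≤b' = maximal b (¬ b') λ c →
      ≤-trans (∧-glb (≤-trans (∧-lowerˡ _ _) b≤b') (∧-lowerʳ _ _)) (least b' c)

    -- Conversely: if b ∧ a is least then b ∧ a = b ∧ ¬ b, so absorption gives
    -- b = b ∧ ¬ (b ∧ ¬ b) = b ∧ ¬ (b ∧ a) ≤ ¬ a.
    absorption⇒maximal : (∀ x → IsGreatest (¬ (x ∧ (¬ x)))) → NegAbsorption → NegMaximal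
    absorption⇒maximal top absorption a b ab-least = ≤-respˡ b≡b∧¬[b∧a] (absorption b a)
      where
      b∧a≡b∧¬b : (b ∧ a) ≡ (b ∧ (¬ b))
      b∧a≡b∧¬b = ≤-antisym (≤-respˡ (∧-comm b a) (ab-least _)) (least b (b ∧ a))

      b≡b∧¬[b∧a] : b ≡ (b ∧ (¬ (b ∧ a)))
      b≡b∧¬[b∧a] = begin
        b                      ≡⟨ sym (top b b) ⟩
        b ∧ (¬ (b ∧ (¬ b)))    ≡⟨ cong (λ w → b ∧ (¬ w)) (sym b∧a≡b∧¬b) ⟩
        b ∧ (¬ (b ∧ a))        ∎
        where open ≡-Reasoning

module Interior {ℓ : Level} {A : Set ℓ} (_∧_ _∨_ : Op₂ A) (¬_ □_ : Op₁ A)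
                (isLattice : IsLattice _≡_ _∨_ _∧_) where
  open IsLattice isLattice using (∧-comm)
  open MeetOrder _∧_ _∨_ isLattice

  BoxCovers : Set ℓ
  BoxCovers = ∀ a → IsGreatest (a ∨ (¬ (□ a)))

  BoxMaximal : Set ℓ
  BoxMaximal = ∀ a b → IsGreatest (a ∨ (¬ b)) → b ≤ □ a

  BoxShift : Set ℓ
  BoxShift = ∀ x y → ((□ (x ∨ (¬ y))) ∧ y) ≡ ((□ x) ∧ y)

  -- ⊤ ∨ ¬ ⊤ is a top, so ⊤ ≤ □ ⊤.
  maximal⇒fixes-top : BoxMaximal → ∀ {⊤} → IsGreatest ⊤ → □ ⊤ ≡ ⊤
  maximal⇒fixes-top maximal ⊤-top =
    ≤-antisym (⊤-top _) (maximal _ _ (λ c → ≤-trans (⊤-top c) (∨-upperˡ _ _)))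

  module _ (covers : BoxCovers) (maximal : BoxMaximal) where

    -- a ∨ ¬ □ a ≤ a' ∨ ¬ □ a is a top whenever a ≤ a'.
    maximal⇒monotone : ∀ {a a'} → a ≤ a' → (□ a) ≤ (□ a')
    maximal⇒monotone a≤a' =
      maximal _ _ (λ c → ≤-trans (covers _ c) (∨-monoˡ _ a≤a'))

    -- With b = □ (x ∨ ¬ y) ∧ y, antitonicity of ¬ gives
    -- (x ∨ ¬ y) ∨ ¬ □ (x ∨ ¬ y) ≤ x ∨ ¬ b, so b ≤ □ x; the reverse
    -- inequality is monotonicity of □.
    maximal⇒shift : (∀ {b b'} → b ≤ b' → (¬ b') ≤ (¬ b)) → BoxShift
    maximal⇒shift antitone x y =
      ≤-antisym (∧-glb (maximal x b x∨¬b-top) (∧-lowerʳ _ _))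
                (∧-glb (≤-trans (∧-lowerˡ _ _) (maximal⇒monotone (∨-upperˡ x (¬ y))))
                       (∧-lowerʳ _ _))
      where
      b : A
      b = (□ (x ∨ (¬ y))) ∧ y

      below : ((x ∨ (¬ y)) ∨ (¬ (□ (x ∨ (¬ y))))) ≤ (x ∨ (¬ b))
      below = ∨-lub (∨-lub (∨-upperˡ _ _) (≤-trans (antitone (∧-lowerʳ _ _)) (∨-upperʳ _ _)))
                    (≤-trans (antitone (∧-lowerˡ _ _)) (∨-upperʳ _ _))

      x∨¬b-top : IsGreatest (x ∨ (¬ b))
      x∨¬b-top c = ≤-trans (covers (x ∨ (¬ y)) c) below

  -- If a ∨ ¬ b is a top it equals ⊤, hence
  -- b ∧ □ a = □ (a ∨ ¬ b) ∧ b = □ ⊤ ∧ b = ⊤ ∧ b = b.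
  shift⇒maximal : ∀ {⊤} → IsGreatest ⊤ → □ ⊤ ≡ ⊤ → BoxShift →
                  ∀ a b → IsGreatest (a ∨ (¬ b)) → b ≤ □ a
  shift⇒maximal {⊤} ⊤-top □⊤≡⊤ shift a b a∨¬b-top = begin
    b ∧ (□ a)              ≡⟨ ∧-comm b (□ a) ⟩
    (□ a) ∧ b              ≡⟨ sym (shift a b) ⟩
    (□ (a ∨ (¬ b))) ∧ b    ≡⟨ cong (λ w → (□ w) ∧ b) (greatest-unique a∨¬b-top ⊤-top) ⟩
    (□ ⊤) ∧ b              ≡⟨ cong (_∧ b) □⊤≡⊤ ⟩
    ⊤ ∧ b                  ≡⟨ ∧-comm ⊤ b ⟩
    b ∧ ⊤                  ≡⟨ ⊤-top b ⟩
    b                      ∎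
    where open ≡-Reasoning

module _ {ℓ : Level} {A : Set ℓ} (_∧_ _∨_ : Op₂ A) (¬_ □_ : Op₁ A) where

  K⇒Eq : InK _∧_ _∨_ ¬_ □_ → InEq _∧_ _∨_ ¬_ □_
  K⇒Eq (isLattice , least , negMaximal , covers , boxMaximal) =
    isLattice , least , top , maximal⇒absorption least negMaximal ,
    (λ x → greatest-unique (covers x) (top x)) ,
    (λ x → maximal⇒fixes-top boxMaximal (top x)) ,
    maximal⇒shift covers boxMaximal (maximal⇒antitone least negMaximal)
    where
    open MeetOrder _∧_ _∨_ isLattice
    open MeetComplement _∧_ _∨_ ¬_ isLattice
    open Interior _∧_ _∨_ ¬_ □_ isLattice

    top : ∀ x → IsGreatest (¬ (x ∧ (¬ x)))
    top = maximal⇒top least negMaximal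

  Eq⇒K : InEq _∧_ _∨_ ¬_ □_ → InK _∧_ _∨_ ¬_ □_
  Eq⇒K (isLattice , least , top , absorption , covers≡top , □top≡top , shift) =
    isLattice , least , absorption⇒maximal least top absorption ,
    (λ a → subst IsGreatest (sym (covers≡top a)) (top a)) ,
    (λ a → shift⇒maximal (top a) (□top≡top a) shift a)
    where
    open MeetOrder _∧_ _∨_ isLattice
    open MeetComplement _∧_ _∨_ ¬_ isLattice
    open Interior _∧_ _∨_ ¬_ □_ isLattice

mainTheorem1 : ∀ {ℓ : Level} {A : Set ℓ} (_∧_ _∨_ : Op₂ A) (¬_ □_ : Op₁ A) →
    InK _∧_ _∨_ ¬_ □_ ⇔ InEq _∧_ _∨_ ¬_ □_
mainTheorem1 _∧_ _∨_ ¬_ □_ = mk⇔ (K⇒Eq _∧_ _∨_ ¬_ □_) (Eq⇒K _∧_ _∨_ ¬_ □_)
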